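{- For every nonnegative integer $k$ there is a finite set $Z$ of finite simple graphs such that for every finite simple graph $G$ with all vertex degrees at most $k$, there is a graph $H$ which is a disjoint union of finitely many graphs from $Z$ (repetitions allowed) and which has the same degree sequence as $G$.
   Context: The degree sequence of a graph $G$ is the list of the degrees of all vertices of $G$ in decreasing order (including vertices of degree $0$). -}

module Defs where

open import Data.Nat using (ℕ; zero; suc; _+_; _≤_)
open import Data.Nat.Properties using (≤-decTotalOrder)
open import Data.Bool using (Bool; true; false; if_then_else_)
open import Data.Fin using (Fin; splitAt)
open import Data.Sum using (inj₁; inj₂)
open import Data.List using (List; []; _∷_; map; reverse; allFin)
open import Data.Nat.ListAction using (sum)
open import Relation.Binary.PropositionalEquality using (_≡_; refl)
import Data.List.Sort as Sort

record Graph : Set where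
  field
    n      : ℕ
    adj    : Fin n → Fin n → Bool
    sym    : ∀ i j → adj i j ≡ adj j i
    irrefl : ∀ i → adj i i ≡ false
open Graph public

degree : (G : Graph) → Fin (n G) → ℕ
degree G i = sum (map (λ j → if adj G i j then 1 else 0) (allFin (n G)))

open Sort ≤-decTotalOrder using (sort)

degreeSequence : Graph → List ℕ
degreeSequence G = reverse (sort (map (degree G) (allFin (n G))))

MaxDegree≤ : Graph → ℕ → Set
MaxDegree≤ G k = ∀ i → degree G i ≤ k

emptyGraph : Graph
emptyGraph = record { n = 0 ; adj = λ () ; sym = λ () ; irrefl = λ () }

private
  adj⊎ : (G H : Graph) → Fin (n G + n H) → Fin (n G + n H) → Bool
  adj⊎ G H i j with splitAt (n G) i | splitAt (n G) j
  ... | inj₁ a | inj₁ b = adj G a b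
  ... | inj₂ a | inj₂ b = adj H a b
  ... | inj₁ _ | inj₂ _ = false
  ... | inj₂ _ | inj₁ _ = false

  sym⊎ : (G H : Graph) → ∀ i j → adj⊎ G H i j ≡ adj⊎ G H j i
  sym⊎ G H i j with splitAt (n G) i | splitAt (n G) j
  ... | inj₁ a | inj₁ b = sym G a b
  ... | inj₂ a | inj₂ b = sym H a b
  ... | inj₁ _ | inj₂ _ = refl
  ... | inj₂ _ | inj₁ _ = refl

  irrefl⊎ : (G H : Graph) → ∀ i → adj⊎ G H i i ≡ false
  irrefl⊎ G H i with splitAt (n G) i
  ... | inj₁ a = irrefl G a
  ... | inj₂ a = irrefl H a

_⊎G_ : Graph → Graph → Graph
G ⊎G H = record { n = n G + n H ; adj = adj⊎ G H ; sym = sym⊎ G H ; irrefl = irrefl⊎ G H }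

⋃G : List Graph → Graph
⋃G []       = emptyGraph
⋃G (G ∷ Gs) = G ⊎G ⋃G Gs

-- If u and v have the same degree d and lie at distance at least 4, delete them and join the
-- i-th neighbour of u to the i-th neighbour of v: every other vertex keeps its degree, so the
-- degree sequence of G is that of a graph with two fewer vertices plus two entries d. Done d + 1
-- times inside one degree class, this peels off 2(d + 1) entries d, the degree sequence of two
-- copies of K_{d+1}. When all degrees are at most k, a ball of radius 3 has at most
-- 1 + k + k² + k³ vertices, so the peeling works in any class of size 2(k + 1) + 1 + k + k² + k³,
-- and by pigeonhole such a class exists once G has more than k + 1 times that many vertices.
-- Hence Z can be taken to consist of all graphs on at most that many vertices.
module Submission where

open import Defs renaming (sym to adj-sym; irrefl to adj-irrefl)
open import Data.Bool using (Bool; true; false; T; T?; not; _∨_; _∧_; if_then_else_)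
open import Data.Bool.Properties using (T-∨; T-≡; ¬-not; ∨-comm; ∨-idem)
open import Data.Empty using (⊥-elim)
open import Data.Fin as Fin using (Fin; _↑ˡ_; _↑ʳ_)
open import Data.Fin.Properties using (splitAt-↑ˡ; splitAt-↑ʳ)
open import Data.List
  using (List; []; _∷_; _++_; length; map; filter; filterᵇ; zip; concatMap; replicate; reverse; lookup; allFin; tabulate; upTo)
open import Data.List.Membership.Propositional using (_∈_; _∉_; find)
open import Data.List.Membership.Propositional.Properties
  using (∈-filter⁺; ∈-filter⁻; ∈-map⁺; ∈-upTo⁺; ∈-++⁺ˡ; ∈-++⁺ʳ; ∈-concatMap⁺; ∈-concatMap⁻)
import Data.List.Membership.DecPropositional as DecMembership
open import Data.List.Properties
  using ( length-++; length-++-≤ʳ; ++-assoc; length-map; length-tabulate; ++-identityʳ; map-cong; map-cong-local; map-∘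
        ; map-tabulate; tabulate-cong; tabulate-lookup; filter-none; filter-accept; filter-reject; filter-all
        ; filter-notAll; filter-≐; filter-++ )
open import Data.List.Relation.Binary.Permutation.Propositional as Perm using (_↭_; prep; ↭-refl; ↭-reflexive; ↭-trans; ↭-sym)
import Data.List.Relation.Binary.Permutation.Propositional.Properties as ↭
open import Data.List.Relation.Binary.Pointwise using (Pointwise-≡⇒≡)
open import Data.List.Relation.Binary.Sublist.Propositional.Properties using (filter-⊆; filter⁺; length-mono-≤)
open import Data.List.Relation.Unary.All as All using (All; []; _∷_)
import Data.List.Relation.Unary.All.Properties as All
open import Data.List.Relation.Unary.Any as Any using (here; there; any?)
open import Data.List.Relation.Unary.Sorted.TotalOrder.Properties using (↗↭↗⇒≋)
open import Data.List.Relation.Unary.Unique.Propositional using (Unique; []; _∷_)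
import Data.List.Relation.Unary.Unique.Propositional.Properties as Unique
open import Data.Nat using (ℕ; zero; suc; _+_; _*_; _^_; _≤_; _<_; z≤n; s≤s; s≤s⁻¹; _≤?_; _<?_) renaming (_≟_ to _≟ℕ_)
open import Data.Nat.ListAction using (sum)
open import Data.Nat.ListAction.Properties using (sum-++)
open import Data.Nat.Properties
  using ( ≤-refl; ≤-reflexive; ≤-trans; ≤-pred; <⇒≤; <⇒≱; ≮⇒≥; ≰⇒>; ≤∧≢⇒<; n<1+n; m≤n⇒m≤1+n; m≤n+m; m≤m*n
        ; +-comm; +-suc; +-identityʳ; *-suc; +-mono-≤; +-monoˡ-≤; *-monoʳ-≤; *-monoˡ-≤; suc-injective
        ; anyUpTo?; ≤-decTotalOrder; ≤-totalOrder; module ≤-Reasoning )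
open import Data.List.Sort ≤-decTotalOrder using (sort-↭; sort-↗)
open import Data.Product using (Σ; ∃; _×_; _,_; proj₁; proj₂; swap)
open import Data.Product.Properties using (≡-dec)
open import Data.Sum using (_⊎_; inj₁; inj₂; [_,_]′)
open import Data.Unit using (tt)
open import Data.Vec as Vec using (Vec)
open import Data.Vec.Properties using (lookup∘tabulate)
open import Function using (id; _∘_)
open import Function.Bundles using (Equivalence)
open import Level using (0ℓ)
open import Relation.Binary.Definitions using (DecidableEquality)
open import Relation.Binary.PropositionalEquality using (_≡_; refl; sym; trans; cong; cong₂; subst; module ≡-Reasoning)
open import Relation.Nullary using (¬_; yes; no; does; isYes)
open import Relation.Nullary.Decidable using (¬?; dec-true; dec-false; toWitness; fromWitness; decidable-stable)
open import Relation.Unary using (Pred; Decidable)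

module _ {A : Set} where

  length-++-≤-+ : (xs ys : List A) {m n : ℕ} → length xs ≤ m → length ys ≤ n → length (xs ++ ys) ≤ m + n
  length-++-≤-+ xs _ xs≤ ys≤ = ≤-trans (≤-reflexive (length-++ xs)) (+-mono-≤ xs≤ ys≤)

  length-filter-partition : {P : Pred A 0ℓ} (P? : Decidable P) (xs : List A) →
                            length xs ≡ length (filter P? xs) + length (filter (¬? ∘ P?) xs)
  length-filter-partition P? []       = refl
  length-filter-partition P? (x ∷ xs) with P? x
  ... | yes _ = cong suc (length-filter-partition P? xs)
  ... | no  _ = trans (cong suc (length-filter-partition P? xs)) (sym (+-suc _ _))

  length-filter-filter : {P Q : Pred A 0ℓ} (P? : Decidable P) (Q? : Decidable Q) (xs : List A) →
                         length (filter P? (filter Q? xs)) ≤ length (filter P? xs)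
  length-filter-filter P? Q? xs = length-mono-≤ (filter⁺ P? P? (λ { refl p → p }) (filter-⊆ Q? xs))

  length-filterᵇ-∨ : (p q : A → Bool) (xs : List A) → (∀ {x} → x ∈ xs → T (p x) → ¬ T (q x)) →
                     length (filterᵇ (λ x → p x ∨ q x) xs) ≡ length (filterᵇ p xs) + length (filterᵇ q xs)
  length-filterᵇ-∨ p q []       _        = refl
  length-filterᵇ-∨ p q (x ∷ xs) disjoint with p x | q x | disjoint (here refl)
  ... | true  | true  | exclusive = ⊥-elim (exclusive _ _)
  ... | true  | false | _ = cong suc (length-filterᵇ-∨ p q xs (disjoint ∘ there))
  ... | false | true  | _ = trans (cong suc (length-filterᵇ-∨ p q xs (disjoint ∘ there))) (sym (+-suc _ _))
  ... | false | false | _ = length-filterᵇ-∨ p q xs (disjoint ∘ there)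

  length-unique-constant : {y : A} {xs : List A} → Unique xs → y ∈ xs → (∀ {x} → x ∈ xs → x ≡ y) → length xs ≡ 1
  length-unique-constant (_ ∷ [])          _ _     = refl
  length-unique-constant ((x≢x′ ∷ _) ∷ _) _ const = ⊥-elim (x≢x′ (trans (const (here refl)) (sym (const (there (here refl))))))

  length-filter-singleton : {P : Pred A 0ℓ} (P? : Decidable P) {y : A} {xs : List A} → Unique xs → y ∈ xs → P y →
                            (∀ {x} → x ∈ xs → P x → x ≡ y) → length (filter P? xs) ≡ 1
  length-filter-singleton P? uniq y∈ Py only =
    length-unique-constant (Unique.filter⁺ P? uniq) (∈-filter⁺ P? y∈ Py) (λ x∈ → let (x∈xs , Px) = ∈-filter⁻ P? x∈ in only x∈xs Px)

  length-filter-empty : {P : Pred A 0ℓ} (P? : Decidable P) {xs : List A} → (∀ {x} → x ∈ xs → ¬ P x) → length (filter P? xs) ≡ 0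
  length-filter-empty P? none = cong length (filter-none P? (All.tabulate none))

  sum-indicator : (p : A → Bool) (xs : List A) → sum (map (λ x → if p x then 1 else 0) xs) ≡ length (filterᵇ p xs)
  sum-indicator p []       = refl
  sum-indicator p (x ∷ xs) with p x
  ... | true  = cong suc (sum-indicator p xs)
  ... | false = sum-indicator p xs

  All-↭-suffix : {P : Pred A 0ℓ} {ds es : List A} (xs : List A) → ds ↭ xs ++ es → All P ds → All P es
  All-↭-suffix xs ds↭ = All.++⁻ʳ xs ∘ ↭.All-resp-↭ ds↭

  length-↭-suffix : {ds es : List A} (x : A) (xs : List A) → ds ↭ (x ∷ xs) ++ es → length es < length ds
  length-↭-suffix {es = es} x xs ds↭ = ≤-trans (s≤s (length-++-≤ʳ es {xs})) (≤-reflexive (sym (↭.↭-length ds↭)))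

module _ {A B : Set} where

  filter-map : {P : Pred B 0ℓ} (P? : Decidable P) (f : A → B) (xs : List A) → filter P? (map f xs) ≡ map f (filter (P? ∘ f) xs)
  filter-map P? f []       = refl
  filter-map P? f (x ∷ xs) with does (P? (f x))
  ... | true  = cong (f x ∷_) (filter-map P? f xs)
  ... | false = filter-map P? f xs

  map-const : (y : B) (xs : List A) → map (λ _ → y) xs ≡ replicate (length xs) y
  map-const y []       = refl
  map-const y (_ ∷ xs) = cong (y ∷_) (map-const y xs)

  length-concatMap-≤ : (f : A → List B) (c : ℕ) {xs : List A} → (∀ {x} → x ∈ xs → length (f x) ≤ c) →
                       length (concatMap f xs) ≤ c * length xs
  length-concatMap-≤ f c {[]}     _       = z≤n
  length-concatMap-≤ f c {x ∷ xs} bounded =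
    ≤-trans (length-++-≤-+ (f x) (concatMap f xs) (bounded (here refl)) (length-concatMap-≤ f c (bounded ∘ there)))
            (≤-reflexive (sym (*-suc c (length xs))))

multiplicity : ℕ → List ℕ → ℕ
multiplicity d ds = length (filter (_≟ℕ d) ds)

multiplicity-↭-∷∷ : {d : ℕ} {ds es : List ℕ} → ds ↭ d ∷ d ∷ es → multiplicity d ds ≡ suc (suc (multiplicity d es))
multiplicity-↭-∷∷ {d} {_} {es} ds↭ = trans (↭.↭-length (↭.filter-↭ (_≟ℕ d) ds↭))
  (cong length (trans (filter-accept (_≟ℕ d) refl) (cong (d ∷_) (filter-accept (_≟ℕ d) {d} {es} refl))))

multiplicities≤⇒length≤ : (t : ℕ) {m : ℕ} (ds : List ℕ) → All (_< t) ds → (∀ {d} → d < t → multiplicity d ds ≤ m) →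
                          length ds ≤ t * m
multiplicities≤⇒length≤ zero    []      []    _     = z≤n
multiplicities≤⇒length≤ (suc t) {m} ds below small = begin
  length ds                          ≡⟨ length-filter-partition (_≟ℕ t) ds ⟩
  multiplicity t ds + length others  ≤⟨ +-mono-≤ (small (n<1+n t)) (multiplicities≤⇒length≤ t others others-below others-small) ⟩
  m + t * m                          ∎
  where
    open ≤-Reasoning
    others = filter (¬? ∘ (_≟ℕ t)) ds
    others-below : All (_< t) others
    others-below = All.tabulate λ d∈ → let (d∈ds , d≢t) = ∈-filter⁻ (¬? ∘ (_≟ℕ t)) d∈ in
      ≤∧≢⇒< (≤-pred (All.lookup below d∈ds)) d≢t
    others-small : ∀ {d} → d < t → multiplicity d others ≤ m
    others-small d<t = ≤-trans (length-filter-filter (_≟ℕ _) (¬? ∘ (_≟ℕ t)) ds) (small (m≤n⇒m≤1+n d<t))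

pigeonhole : (t : ℕ) {m : ℕ} (ds : List ℕ) → All (_< t) ds → t * m < length ds → ∃ λ d → d < t × m < multiplicity d ds
pigeonhole t {m} ds below long with anyUpTo? (λ d → m <? multiplicity d ds) t
... | yes big  = big
... | no  none = ⊥-elim (<⇒≱ long (multiplicities≤⇒length≤ t ds below (λ d<t → ≮⇒≥ (λ big → none (_ , d<t , big)))))

module Deletion {A : Set} (_≟_ : DecidableEquality A) where

  delete : A → List A → List A
  delete a = filter (λ x → ¬? (x ≟ a))

  ∈-delete⁺ : {a x : A} {xs : List A} → x ∈ xs → ¬ x ≡ a → x ∈ delete a xs
  ∈-delete⁺ {a} = ∈-filter⁺ (λ x → ¬? (x ≟ a))

  ∈-delete⁻ : {a x : A} {xs : List A} → x ∈ delete a xs → x ∈ xs × ¬ x ≡ a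
  ∈-delete⁻ {a} = ∈-filter⁻ (λ x → ¬? (x ≟ a))

  ↭-delete : {a : A} {xs : List A} → Unique xs → a ∈ xs → xs ↭ a ∷ delete a xs
  ↭-delete {a} {_ ∷ xs} (a∉xs ∷ _) (here refl)
    rewrite filter-reject (λ x → ¬? (x ≟ a)) {a} {xs} (λ a≢a → a≢a refl)
          | filter-all (λ x → ¬? (x ≟ a)) (All.map (λ a≢x x≡a → a≢x (sym x≡a)) a∉xs) = ↭-refl
  ↭-delete {a} {x ∷ xs} (x∉xs ∷ uniq) (there a∈xs)
    rewrite filter-accept (λ y → ¬? (y ≟ a)) {x} {xs} (All.lookup x∉xs a∈xs) =
    ↭-trans (prep x (↭-delete uniq a∈xs)) (Perm.swap x a ↭-refl)

  length-unique-⊆ : {xs ys : List A} → Unique xs → (∀ {x} → x ∈ xs → x ∈ ys) → length xs ≤ length ys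
  length-unique-⊆ []                   _     = z≤n
  length-unique-⊆ {x ∷ xs} {ys} (x∉xs ∷ uniq) xs⊆ys =
    ≤-trans (s≤s (length-unique-⊆ uniq (λ y∈xs → ∈-delete⁺ (xs⊆ys (there y∈xs)) (λ y≡x → All.lookup x∉xs y∈xs (sym y≡x)))))
            (filter-notAll (λ y → ¬? (y ≟ x)) ys (Any.map (λ x≡y y≢x → y≢x (sym x≡y)) (xs⊆ys (here refl))))

module ZipPartners {A : Set} (_≟_ : DecidableEquality A) where

  open DecMembership (≡-dec _≟_ _≟_) using (_∈?_)

  _∈ᵇ_ : A × A → List (A × A) → Bool
  e ∈ᵇ E = isYes (e ∈? E)

  ∈⇒∈ᵇ : {e : A × A} {E : List (A × A)} → e ∈ E → T (e ∈ᵇ E)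
  ∈⇒∈ᵇ {e} {E} = fromWitness {a? = e ∈? E}

  ∈ᵇ⇒∈ : {e : A × A} {E : List (A × A)} → T (e ∈ᵇ E) → e ∈ E
  ∈ᵇ⇒∈ {e} {E} = toWitness {a? = e ∈? E}

  ∈-zip⁻ : {a b : A} (xs ys : List A) → (a , b) ∈ zip xs ys → a ∈ xs × b ∈ ys
  ∈-zip⁻ (_ ∷ _)  (_ ∷ _)  (here refl) = here refl , here refl
  ∈-zip⁻ (_ ∷ xs) (_ ∷ ys) (there ab∈) = let (a∈ , b∈) = ∈-zip⁻ xs ys ab∈ in there a∈ , there b∈

  ∈-zip-swap : {a b : A} (xs ys : List A) → (a , b) ∈ zip xs ys → (b , a) ∈ zip ys xs
  ∈-zip-swap (_ ∷ _)  (_ ∷ _)  (here refl) = here refl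
  ∈-zip-swap (_ ∷ xs) (_ ∷ ys) (there ab∈) = there (∈-zip-swap xs ys ab∈)

  zip-partner : {a : A} (xs ys : List A) → length xs ≡ length ys → a ∈ xs → ∃ λ b → (a , b) ∈ zip xs ys
  zip-partner (_ ∷ _)  (y ∷ _)  _   (here refl) = y , here refl
  zip-partner (_ ∷ xs) (_ ∷ ys) len (there a∈)  = let (b , ab∈) = zip-partner xs ys (suc-injective len) a∈ in b , there ab∈

  zip-partner-unique : {a b b′ : A} (xs ys : List A) → Unique xs → (a , b) ∈ zip xs ys → (a , b′) ∈ zip xs ys → b ≡ b′
  zip-partner-unique (_ ∷ _)  (_ ∷ _)  _          (here refl) (here refl)  = refl
  zip-partner-unique (_ ∷ xs) (_ ∷ ys) (a∉xs ∷ _) (here refl) (there ab′∈) = ⊥-elim (All.lookup a∉xs (proj₁ (∈-zip⁻ xs ys ab′∈)) refl)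
  zip-partner-unique (_ ∷ xs) (_ ∷ ys) (a∉xs ∷ _) (there ab∈) (here refl)  = ⊥-elim (All.lookup a∉xs (proj₁ (∈-zip⁻ xs ys ab∈)) refl)
  zip-partner-unique (_ ∷ xs) (_ ∷ ys) (_ ∷ uniq) (there ab∈) (there ab′∈) = zip-partner-unique xs ys uniq ab∈ ab′∈

  module _ (xs ys : List A) where

    partners : A → List A → List A
    partners a = filterᵇ (λ c → (a , c) ∈ᵇ zip xs ys)

    length-partners : {a : A} {W : List A} → Unique xs → length xs ≡ length ys → Unique W →
                      (∀ {b} → b ∈ ys → b ∈ W) → a ∈ xs → length (partners a W) ≡ 1
    length-partners {a} uniq len uniqW ys⊆W a∈xs =
      let (b , ab∈) = zip-partner xs ys len a∈xs in
      length-filter-singleton (λ c → T? ((a , c) ∈ᵇ zip xs ys)) uniqW (ys⊆W (proj₂ (∈-zip⁻ xs ys ab∈))) (∈⇒∈ᵇ ab∈)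
        (λ _ ac∈ → sym (zip-partner-unique xs ys uniq ab∈ (∈ᵇ⇒∈ ac∈)))

    length-partners-∉ : {a : A} (W : List A) → a ∉ xs → length (partners a W) ≡ 0
    length-partners-∉ {a} W a∉xs =
      length-filter-empty (λ c → T? ((a , c) ∈ᵇ zip xs ys)) {W} (λ _ ac∈ → a∉xs (proj₁ (∈-zip⁻ xs ys (∈ᵇ⇒∈ ac∈))))

    partners-swap : (a : A) (W : List A) → filterᵇ (λ c → (c , a) ∈ᵇ zip ys xs) W ≡ partners a W
    partners-swap a = filter-≐ (λ c → T? ((c , a) ∈ᵇ zip ys xs)) (λ c → T? ((a , c) ∈ᵇ zip xs ys))
      ((λ ca∈ → ∈⇒∈ᵇ (∈-zip-swap ys xs (∈ᵇ⇒∈ ca∈))) , (λ ac∈ → ∈⇒∈ᵇ (∈-zip-swap xs ys (∈ᵇ⇒∈ ac∈))))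

does-≟-sym : {A : Set} (_≟_ : DecidableEquality A) (a b : A) → does (a ≟ b) ≡ does (b ≟ a)
does-≟-sym _≟_ a b with a ≟ b | b ≟ a
... | yes _   | yes _   = refl
... | no  _   | no  _   = refl
... | yes a≡b | no  b≢a = ⊥-elim (b≢a (sym a≡b))
... | no  a≢b | yes b≡a = ⊥-elim (a≢b (sym b≡a))

degreeList : Graph → List ℕ
degreeList G = map (degree G) (allFin (n G))

degreeSequence-↭ : (G H : Graph) → degreeList G ↭ degreeList H → degreeSequence G ≡ degreeSequence H
degreeSequence-↭ G H G↭H = cong reverse (Pointwise-≡⇒≡ (↗↭↗⇒≋ ≤-totalOrder (sort-↗ (degreeList G)) (sort-↗ (degreeList H))
  (Perm.↭⇒↭ₛ (↭-trans (sort-↭ (degreeList G)) (↭-trans G↭H (↭-sym (sort-↭ (degreeList H))))))))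

tabulate-+ : {X : Set} (m k : ℕ) (f : Fin (m + k) → X) → tabulate f ≡ tabulate (f ∘ (_↑ˡ k)) ++ tabulate (f ∘ (m ↑ʳ_))
tabulate-+ zero    k f = refl
tabulate-+ (suc m) k f = cong (f Fin.zero ∷_) (tabulate-+ m k (f ∘ Fin.suc))

sum-tabulate-zero : {m : ℕ} (f : Fin m → ℕ) → (∀ i → f i ≡ 0) → sum (tabulate f) ≡ 0
sum-tabulate-zero {zero}  f _        = refl
sum-tabulate-zero {suc m} f vanishes rewrite vanishes Fin.zero = sum-tabulate-zero (f ∘ Fin.suc) (vanishes ∘ Fin.suc)

module _ (G H : Graph) where

  private
    GH = G ⊎G H

    row : (X : Graph) → Fin (n X) → Fin (n X) → ℕ
    row X i j = if adj X i j then 1 else 0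

    degree-row : (X : Graph) (i : Fin (n X)) → degree X i ≡ sum (tabulate (row X i))
    degree-row X i = cong sum (map-tabulate id (row X i))

    degree-⊎ : (i : Fin (n G + n H)) →
               degree GH i ≡ sum (tabulate (λ j → row GH i (j ↑ˡ n H))) + sum (tabulate (λ j → row GH i (n G ↑ʳ j)))
    degree-⊎ i = trans (degree-row GH i) (trans (cong sum (tabulate-+ (n G) (n H) (row GH i)))
                                                (sum-++ (tabulate (λ j → row GH i (j ↑ˡ n H))) _))

  degree-↑ˡ : (a : Fin (n G)) → degree GH (a ↑ˡ n H) ≡ degree G a
  degree-↑ˡ a = begin
    degree GH (a ↑ˡ n H)                            ≡⟨ degree-⊎ (a ↑ˡ n H) ⟩
    sum (tabulate (λ j → row GH (a ↑ˡ n H) (j ↑ˡ n H))) + sum (tabulate (λ j → row GH (a ↑ˡ n H) (n G ↑ʳ j)))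
                                                    ≡⟨ cong₂ _+_ (cong sum (tabulate-cong inside)) (sum-tabulate-zero _ across) ⟩
    sum (tabulate (row G a)) + 0                    ≡⟨ +-identityʳ _ ⟩
    sum (tabulate (row G a))                        ≡⟨ sym (degree-row G a) ⟩
    degree G a                                      ∎
    where
      open ≡-Reasoning
      inside : ∀ b → row GH (a ↑ˡ n H) (b ↑ˡ n H) ≡ row G a b
      inside b rewrite splitAt-↑ˡ (n G) a (n H) | splitAt-↑ˡ (n G) b (n H) = refl
      across : ∀ b → row GH (a ↑ˡ n H) (n G ↑ʳ b) ≡ 0
      across b rewrite splitAt-↑ˡ (n G) a (n H) | splitAt-↑ʳ (n G) (n H) b = refl

  degree-↑ʳ : (a : Fin (n H)) → degree GH (n G ↑ʳ a) ≡ degree H a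
  degree-↑ʳ a = begin
    degree GH (n G ↑ʳ a)                            ≡⟨ degree-⊎ (n G ↑ʳ a) ⟩
    sum (tabulate (λ j → row GH (n G ↑ʳ a) (j ↑ˡ n H))) + sum (tabulate (λ j → row GH (n G ↑ʳ a) (n G ↑ʳ j)))
                                                    ≡⟨ cong₂ _+_ (sum-tabulate-zero _ across) (cong sum (tabulate-cong inside)) ⟩
    sum (tabulate (row H a))                        ≡⟨ sym (degree-row H a) ⟩
    degree H a                                      ∎
    where
      open ≡-Reasoning
      inside : ∀ b → row GH (n G ↑ʳ a) (n G ↑ʳ b) ≡ row H a b
      inside b rewrite splitAt-↑ʳ (n G) (n H) a | splitAt-↑ʳ (n G) (n H) b = refl
      across : ∀ b → row GH (n G ↑ʳ a) (b ↑ˡ n H) ≡ 0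
      across b rewrite splitAt-↑ʳ (n G) (n H) a | splitAt-↑ˡ (n G) b (n H) = refl

  degreeList-⊎ : degreeList GH ≡ degreeList G ++ degreeList H
  degreeList-⊎ = begin
    map (degree GH) (allFin (n G + n H))                                  ≡⟨ map-tabulate id (degree GH) ⟩
    tabulate (degree GH)                                                  ≡⟨ tabulate-+ (n G) (n H) (degree GH) ⟩
    tabulate (degree GH ∘ (_↑ˡ n H)) ++ tabulate (degree GH ∘ (n G ↑ʳ_))  ≡⟨ cong₂ _++_ (tabulate-cong degree-↑ˡ) (tabulate-cong degree-↑ʳ) ⟩
    tabulate (degree G) ++ tabulate (degree H)                            ≡⟨ sym (cong₂ _++_ (map-tabulate id (degree G)) (map-tabulate id (degree H))) ⟩
    degreeList G ++ degreeList H                                          ∎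
    where open ≡-Reasoning

degreeList-⋃ : (Hs : List Graph) → degreeList (⋃G Hs) ≡ concatMap degreeList Hs
degreeList-⋃ []       = refl
degreeList-⋃ (G ∷ Hs) = trans (degreeList-⊎ G (⋃G Hs)) (cong (degreeList G ++_) (degreeList-⋃ Hs))

-- Vertices form a duplicate-free list in a type with decidable equality, so that deleting
-- vertices needs no renumbering.
record ListGraph (A : Set) : Set where
  field
    edge            : A → A → Bool
    vertices        : List A
    vertices-unique : Unique vertices
    edge-sym        : ∀ a b → edge a b ≡ edge b a
    edge-irrefl     : ∀ a → ¬ T (edge a a)
open ListGraph public

module _ {A : Set} (g : ListGraph A) where

  neighbours : A → List A
  neighbours a = filterᵇ (edge g a) (vertices g)

  deg : A → ℕ
  deg a = length (neighbours a)

  degrees : List ℕ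
  degrees = map deg (vertices g)

  MaxDegreeᴸ≤ : ℕ → Set
  MaxDegreeᴸ≤ k = All (_≤ k) degrees

  deg≤ : {k : ℕ} → MaxDegreeᴸ≤ k → {a : A} → a ∈ vertices g → deg a ≤ k
  deg≤ bounded = All.lookup (All.map⁻ bounded)

  ∈-neighbours⁻ : {x a : A} → a ∈ neighbours x → a ∈ vertices g × T (edge g x a)
  ∈-neighbours⁻ = ∈-filter⁻ (T? ∘ edge g _)

  -- u and v are at distance at least 4.
  record Distant (u v : A) : Set where
    field
      u≢v                 : ¬ u ≡ v
      ¬u~v                : ¬ T (edge g u v)
      no-common-neighbour : ∀ {x} → x ∈ vertices g → T (edge g u x) → ¬ T (edge g v x)
      no-crossing-edge    : ∀ {x y} → x ∈ vertices g → y ∈ vertices g → T (edge g u x) → T (edge g v y) → ¬ T (edge g x y)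

fromGraph : (G : Graph) → ListGraph (Fin (n G))
fromGraph G = record
  { edge            = adj G
  ; vertices        = allFin (n G)
  ; vertices-unique = Unique.allFin⁺ (n G)
  ; edge-sym        = adj-sym G
  ; edge-irrefl     = λ i → subst T (adj-irrefl G i)
  }

degrees-fromGraph : (G : Graph) → degrees (fromGraph G) ≡ degreeList G
degrees-fromGraph G = map-cong (λ i → sym (sum-indicator (adj G i) (allFin (n G)))) (allFin (n G))

maxDegree-fromGraph : (G : Graph) {k : ℕ} → MaxDegree≤ G k → MaxDegreeᴸ≤ (fromGraph G) k
maxDegree-fromGraph G {k} bounded = subst (All (_≤ k)) (sym (degrees-fromGraph G)) (All.map⁺ (All.tabulate λ {i} _ → bounded i))

module Surgery {A : Set} (_≟_ : DecidableEquality A) (g : ListGraph A) {u v : A}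
               (u∈ : u ∈ vertices g) (v∈ : v ∈ vertices g) (far : Distant g u v) (same : deg g u ≡ deg g v) where

  open Distant far
  open Deletion _≟_
  open ZipPartners _≟_

  Nu Nv rest : List A
  Nu   = neighbours g u
  Nv   = neighbours g v
  rest = delete v (delete u (vertices g))

  matched : A → A → Bool
  matched a b = (a , b) ∈ᵇ zip Nu Nv ∨ (b , a) ∈ᵇ zip Nu Nv

  Nu∩Nv-empty : {a : A} → a ∈ Nu → ¬ a ∈ Nv
  Nu∩Nv-empty a∈Nu a∈Nv = let (a∈ , u~a) = ∈-neighbours⁻ g a∈Nu in no-common-neighbour a∈ u~a (proj₂ (∈-neighbours⁻ g a∈Nv))

  Nu⊆rest : {a : A} → a ∈ Nu → a ∈ rest
  Nu⊆rest a∈Nu with ∈-neighbours⁻ g a∈Nu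
  ... | a∈ , u~a = ∈-delete⁺ (∈-delete⁺ a∈ λ { refl → edge-irrefl g u u~a }) λ { refl → ¬u~v u~a }

  Nv⊆rest : {a : A} → a ∈ Nv → a ∈ rest
  Nv⊆rest a∈Nv with ∈-neighbours⁻ g a∈Nv
  ... | a∈ , v~a = ∈-delete⁺ (∈-delete⁺ a∈ λ { refl → ¬u~v (subst T (edge-sym g v u) v~a) }) λ { refl → edge-irrefl g v v~a }

  rest⊆vertices : {a : A} → a ∈ rest → a ∈ vertices g
  rest⊆vertices a∈ = proj₁ (∈-delete⁻ (proj₁ (∈-delete⁻ a∈)))

  rest-unique : Unique rest
  rest-unique = Unique.filter⁺ _ (Unique.filter⁺ _ (vertices-unique g))

  vertices-↭ : vertices g ↭ u ∷ v ∷ rest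
  vertices-↭ = ↭-trans (↭-delete (vertices-unique g) u∈)
    (prep u (↭-delete (Unique.filter⁺ _ (vertices-unique g)) (∈-delete⁺ v∈ (u≢v ∘ sym))))

  matched⇒sides : {a b : A} → T (matched a b) → (a ∈ Nu × b ∈ Nv) ⊎ (a ∈ Nv × b ∈ Nu)
  matched⇒sides ab with Equivalence.to T-∨ ab
  ... | inj₁ ab∈ = inj₁ (∈-zip⁻ Nu Nv (∈ᵇ⇒∈ ab∈))
  ... | inj₂ ba∈ = inj₂ (swap (∈-zip⁻ Nu Nv (∈ᵇ⇒∈ ba∈)))

  matched⇒¬edge : {a b : A} → T (matched a b) → ¬ T (edge g a b)
  matched⇒¬edge {a} {b} ab with matched⇒sides ab
  ... | inj₁ (a∈Nu , b∈Nv) =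
    let (a∈ , u~a) = ∈-neighbours⁻ g a∈Nu ; (b∈ , v~b) = ∈-neighbours⁻ g b∈Nv in no-crossing-edge a∈ b∈ u~a v~b
  ... | inj₂ (a∈Nv , b∈Nu) =
    let (a∈ , v~a) = ∈-neighbours⁻ g a∈Nv ; (b∈ , u~b) = ∈-neighbours⁻ g b∈Nu in
    λ a~b → no-crossing-edge b∈ a∈ u~b v~a (subst T (edge-sym g a b) a~b)

  matched-irrefl : {a : A} → ¬ T (matched a a)
  matched-irrefl aa with matched⇒sides aa
  ... | inj₁ (a∈Nu , a∈Nv) = Nu∩Nv-empty a∈Nu a∈Nv
  ... | inj₂ (a∈Nv , a∈Nu) = Nu∩Nv-empty a∈Nu a∈Nv

  result : ListGraph A
  result = record
    { edge            = λ a b → edge g a b ∨ matched a b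
    ; vertices        = rest
    ; vertices-unique = rest-unique
    ; edge-sym        = λ a b → cong₂ _∨_ (edge-sym g a b) (∨-comm ((a , b) ∈ᵇ zip Nu Nv) _)
    ; edge-irrefl     = λ a aa → [ edge-irrefl g a , matched-irrefl ]′ (Equivalence.to T-∨ aa)
    }

  length-matched : (a : A) → length (filterᵇ (matched a) rest) ≡ length (partners Nu Nv a rest) + length (partners Nv Nu a rest)
  length-matched a = trans (length-filterᵇ-∨ _ _ rest disjoint)
                           (cong (length (partners Nu Nv a rest) +_) (cong length (partners-swap Nv Nu a rest)))
    where
      disjoint : ∀ {c} → c ∈ rest → T ((a , c) ∈ᵇ zip Nu Nv) → ¬ T ((c , a) ∈ᵇ zip Nu Nv)
      disjoint _ ac ca = Nu∩Nv-empty (proj₁ (∈-zip⁻ Nu Nv (∈ᵇ⇒∈ ac))) (proj₂ (∈-zip⁻ Nu Nv (∈ᵇ⇒∈ ca)))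

  module _ {a : A} (a∈rest : a ∈ rest) where

    private
      a∈ : a ∈ vertices g
      a∈ = rest⊆vertices a∈rest

      adjacent : {x : A} → edge g a x ≡ true → T (edge g x a)
      adjacent {x} a~x = Equivalence.from T-≡ (trans (edge-sym g x a) a~x)

      one-partner : (x y : A) → deg g x ≡ deg g y → (∀ {b} → b ∈ neighbours g y → b ∈ rest) → edge g a x ≡ true →
                    length (partners (neighbours g x) (neighbours g y) a rest) ≡ 1
      one-partner x y same-deg Ny⊆rest a~x = length-partners (neighbours g x) (neighbours g y)
        (Unique.filter⁺ _ (vertices-unique g)) same-deg rest-unique Ny⊆rest (∈-filter⁺ _ a∈ (adjacent a~x))

      no-partner : (x y : A) → edge g a x ≡ false → length (partners (neighbours g x) (neighbours g y) a rest) ≡ 0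
      no-partner x y a≁x = length-partners-∉ (neighbours g x) (neighbours g y) rest
        (λ a∈Nx → subst T (trans (edge-sym g x a) a≁x) (proj₂ (∈-neighbours⁻ g a∈Nx)))

    lost-edges-restored : length (filterᵇ (matched a) rest) ≡ length (filterᵇ (edge g a) (u ∷ v ∷ []))
    lost-edges-restored with edge g a u in a~u
    ... | true with edge g a v in a~v
    ...   | true  = ⊥-elim (no-common-neighbour a∈ (adjacent a~u) (adjacent a~v))
    ...   | false = trans (length-matched a) (cong₂ _+_ (one-partner u v same Nv⊆rest a~u) (no-partner v u a~v))
    lost-edges-restored | false with edge g a v in a~v
    ...   | true  = trans (length-matched a) (cong₂ _+_ (no-partner u v a~u) (one-partner v u (sym same) Nu⊆rest a~v))
    ...   | false = trans (length-matched a) (cong₂ _+_ (no-partner u v a~u) (no-partner v u a~v))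

  deg-result : {a : A} → a ∈ rest → deg result a ≡ deg g a
  deg-result {a} a∈rest = begin
    length (filterᵇ (λ b → edge g a b ∨ matched a b) rest)
      ≡⟨ length-filterᵇ-∨ (edge g a) (matched a) rest (λ _ a~b ab → matched⇒¬edge ab a~b) ⟩
    length (filterᵇ (edge g a) rest) + length (filterᵇ (matched a) rest)
      ≡⟨ cong (length (filterᵇ (edge g a) rest) +_) (lost-edges-restored a∈rest) ⟩
    length (filterᵇ (edge g a) rest) + length (filterᵇ (edge g a) (u ∷ v ∷ []))
      ≡⟨ +-comm (length (filterᵇ (edge g a) rest)) _ ⟩
    length (filterᵇ (edge g a) (u ∷ v ∷ [])) + length (filterᵇ (edge g a) rest)
      ≡⟨ sym (length-++ (filterᵇ (edge g a) (u ∷ v ∷ []))) ⟩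
    length (filterᵇ (edge g a) (u ∷ v ∷ []) ++ filterᵇ (edge g a) rest)
      ≡⟨ cong length (sym (filter-++ (T? ∘ edge g a) (u ∷ v ∷ []) rest)) ⟩
    length (filterᵇ (edge g a) (u ∷ v ∷ rest))
      ≡⟨ ↭.↭-length (↭.filter-↭ (T? ∘ edge g a) (↭-sym vertices-↭)) ⟩
    deg g a ∎
    where open ≡-Reasoning

  degrees-↭ : degrees g ↭ deg g u ∷ deg g u ∷ degrees result
  degrees-↭ = ↭-trans (↭.map⁺ (deg g) vertices-↭)
    (↭-reflexive (cong₂ (λ d ds → deg g u ∷ d ∷ ds) (sym same) (map-cong-local (All.tabulate (sym ∘ deg-result)))))

ballSize : ℕ → ℕ
ballSize k = k ^ 0 + (k ^ 1 + (k ^ 2 + k ^ 3))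

module _ {A : Set} (g : ListGraph A) where

  walkEnds : ℕ → A → List A
  walkEnds zero    u = u ∷ []
  walkEnds (suc r) u = concatMap (neighbours g) (walkEnds r u)

  ball : A → List A
  ball u = walkEnds 0 u ++ walkEnds 1 u ++ walkEnds 2 u ++ walkEnds 3 u

  walkEnds-step : ∀ r {u x y} → x ∈ walkEnds r u → y ∈ vertices g → T (edge g x y) → y ∈ walkEnds (suc r) u
  walkEnds-step _ x∈ y∈ x~y = ∈-concatMap⁺ (neighbours g) (Any.map (λ { refl → ∈-filter⁺ _ y∈ x~y }) x∈)

  walkEnds⊆vertices : ∀ r {u x} → u ∈ vertices g → x ∈ walkEnds r u → x ∈ vertices g
  walkEnds⊆vertices zero        u∈ (here refl) = u∈
  walkEnds⊆vertices (suc r) {u} _  x∈          =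
    let (_ , _ , x∈N) = find (∈-concatMap⁻ (neighbours g) {xs = walkEnds r u} x∈) in proj₁ (∈-neighbours⁻ g x∈N)

  length-ball : {k : ℕ} → MaxDegreeᴸ≤ g k → {u : A} → u ∈ vertices g → length (ball u) ≤ ballSize k
  length-ball {k} bounded {u} u∈ =
    length-++-≤-+ (walkEnds 0 u) (walkEnds 1 u ++ walkEnds 2 u ++ walkEnds 3 u) (length-walkEnds 0)
      (length-++-≤-+ (walkEnds 1 u) (walkEnds 2 u ++ walkEnds 3 u) (length-walkEnds 1)
        (length-++-≤-+ (walkEnds 2 u) (walkEnds 3 u) (length-walkEnds 2) (length-walkEnds 3)))
    where
      length-walkEnds : ∀ r → length (walkEnds r u) ≤ k ^ r
      length-walkEnds zero    = s≤s z≤n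
      length-walkEnds (suc r) =
        ≤-trans (length-concatMap-≤ (neighbours g) k {walkEnds r u} (λ x∈ → deg≤ g bounded (walkEnds⊆vertices r u∈ x∈)))
                (*-monoʳ-≤ k (length-walkEnds r))

  outside-ball⇒distant : {u v : A} → u ∈ vertices g → v ∈ vertices g → v ∉ ball u → Distant g u v
  outside-ball⇒distant {u} {v} u∈ v∈ v∉ball = record
    { u≢v                 = λ { refl → v∉ball (at-distance-0 (here refl)) }
    ; ¬u~v                = λ u~v → v∉ball (at-distance-1 (walkEnds-step 0 (here refl) v∈ u~v))
    ; no-common-neighbour = λ x∈ u~x v~x →
        v∉ball (at-distance-2 (walkEnds-step 1 (walkEnds-step 0 (here refl) x∈ u~x) v∈ (reverse-edge v~x)))
    ; no-crossing-edge    = λ x∈ y∈ u~x v~y x~y →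
        v∉ball (at-distance-3 (walkEnds-step 2 (walkEnds-step 1 (walkEnds-step 0 (here refl) x∈ u~x) y∈ x~y) v∈ (reverse-edge v~y)))
    }
    where
      reverse-edge : ∀ {x y} → T (edge g x y) → T (edge g y x)
      reverse-edge {x} {y} = subst T (edge-sym g x y)
      at-distance-0 : v ∈ walkEnds 0 u → v ∈ ball u
      at-distance-0 = ∈-++⁺ˡ
      at-distance-1 : v ∈ walkEnds 1 u → v ∈ ball u
      at-distance-1 = ∈-++⁺ʳ (walkEnds 0 u) ∘ ∈-++⁺ˡ
      at-distance-2 : v ∈ walkEnds 2 u → v ∈ ball u
      at-distance-2 = ∈-++⁺ʳ (walkEnds 0 u) ∘ ∈-++⁺ʳ (walkEnds 1 u) ∘ ∈-++⁺ˡ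
      at-distance-3 : v ∈ walkEnds 3 u → v ∈ ball u
      at-distance-3 = ∈-++⁺ʳ (walkEnds 0 u) ∘ ∈-++⁺ʳ (walkEnds 1 u) ∘ ∈-++⁺ʳ (walkEnds 2 u)

module PairingOff {A : Set} (_≟_ : DecidableEquality A) (k : ℕ) where

  open DecMembership _≟_ using (_∈?_)
  open Deletion _≟_ using (length-unique-⊆)

  distant-pair : (g : ListGraph A) → MaxDegreeᴸ≤ g k → (C : List A) → Unique C → (∀ {a} → a ∈ C → a ∈ vertices g) →
                 2 + ballSize k ≤ length C → ∃ λ u → ∃ λ v → u ∈ C × v ∈ C × Distant g u v
  distant-pair g bounded (u ∷ others) (_ ∷ others-unique) C⊆V (s≤s large) with any? (λ v → ¬? (v ∈? ball g u)) others
  ... | yes outside = let (v , v∈ , v∉ball) = find outside in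
    u , v , here refl , there v∈ , outside-ball⇒distant g (C⊆V (here refl)) (C⊆V (there v∈)) v∉ball
  ... | no  inside  = ⊥-elim (<⇒≱ large (≤-trans (length-unique-⊆ others-unique others⊆ball) (length-ball g bounded (C⊆V (here refl)))))
    where
      others⊆ball : ∀ {v} → v ∈ others → v ∈ ball g u
      others⊆ball v∈ = decidable-stable (_ ∈? ball g u) (λ v∉ball → inside (Any.map (λ { refl → v∉ball }) v∈))

  degreeClass : ListGraph A → ℕ → List A
  degreeClass g d = filter (λ a → deg g a ≟ℕ d) (vertices g)

  ∈-degreeClass⁻ : {g : ListGraph A} {d : ℕ} {a : A} → a ∈ degreeClass g d → a ∈ vertices g × deg g a ≡ d
  ∈-degreeClass⁻ {g} {d} = ∈-filter⁻ (λ a → deg g a ≟ℕ d)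

  length-degreeClass : (g : ListGraph A) (d : ℕ) → length (degreeClass g d) ≡ multiplicity d (degrees g)
  length-degreeClass g d = sym (trans (cong length (filter-map (_≟ℕ d) (deg g) (vertices g)))
                                      (length-map (deg g) (filter ((_≟ℕ d) ∘ deg g) (vertices g))))

  remove-distant-pair : (g : ListGraph A) (d : ℕ) → MaxDegreeᴸ≤ g k → 2 + ballSize k ≤ multiplicity d (degrees g) →
                        Σ (ListGraph A) λ g′ → degrees g ↭ d ∷ d ∷ degrees g′
  remove-distant-pair g d bounded many
    with distant-pair g bounded (degreeClass g d) (Unique.filter⁺ _ (vertices-unique g)) (proj₁ ∘ ∈-degreeClass⁻ {g} {d})
                      (subst (_ ≤_) (sym (length-degreeClass g d)) many)
  ... | u , v , u∈C , v∈C , far with ∈-degreeClass⁻ {g} {d} u∈C | ∈-degreeClass⁻ {g} {d} v∈C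
  ...   | u∈ , refl | v∈ , v-deg = Surgery.result _≟_ g u∈ v∈ far (sym v-deg) , Surgery.degrees-↭ _≟_ g u∈ v∈ far (sym v-deg)

  pair-off : (j d : ℕ) (g : ListGraph A) → MaxDegreeᴸ≤ g k → j * 2 + ballSize k ≤ multiplicity d (degrees g) →
             Σ (ListGraph A) λ g′ → degrees g ↭ replicate j d ++ replicate j d ++ degrees g′
  pair-off zero    d g _       _    = g , ↭-refl
  pair-off (suc j) d g bounded many with remove-distant-pair g d bounded (≤-trans (s≤s (s≤s (m≤n+m _ (j * 2)))) many)
  ... | g′ , g↭ with ↭.All-resp-↭ g↭ bounded
  ...   | _ ∷ _ ∷ bounded′ =
    let (g″ , g′↭) = pair-off j d g′ bounded′ (s≤s⁻¹ (s≤s⁻¹ (subst (_ ≤_) (multiplicity-↭-∷∷ g↭) many))) in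
    g″ , ↭-trans g↭ (prep d (↭-trans (prep d g′↭) (↭-sym (↭.shift d (replicate j d) (replicate j d ++ degrees g″)))))

module _ {A : Set} (_≟_ : DecidableEquality A) where

  open Deletion _≟_ using (↭-delete)

  complete : (xs : List A) → Unique xs → ListGraph A
  complete xs uniq = record
    { edge            = λ a b → not (does (a ≟ b))
    ; vertices        = xs
    ; vertices-unique = uniq
    ; edge-sym        = λ a b → cong not (does-≟-sym _≟_ a b)
    ; edge-irrefl     = λ a → subst (T ∘ not) (dec-true (a ≟ a) refl)
    }

  deg-complete : {xs : List A} (uniq : Unique xs) {a : A} → a ∈ xs → suc (deg (complete xs uniq) a) ≡ length xs
  deg-complete {xs} uniq {a} a∈ =
    trans (cong (suc ∘ length) (filter-≐ (T? ∘ (λ b → not (does (a ≟ b)))) (λ b → ¬? (b ≟ a)) (distinct , nonequal) xs))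
          (sym (↭.↭-length (↭-delete uniq a∈)))
    where
      distinct : ∀ {b} → T (not (does (a ≟ b))) → ¬ b ≡ a
      distinct a≢b refl = subst (T ∘ not) (dec-true (a ≟ a) refl) a≢b
      nonequal : ∀ {b} → ¬ b ≡ a → T (not (does (a ≟ b)))
      nonequal {b} b≢a = subst (T ∘ not) (sym (dec-false (a ≟ b) (b≢a ∘ sym))) tt

degrees-complete-allFin : (d : ℕ) → degrees (complete Fin._≟_ (allFin (suc d)) (Unique.allFin⁺ (suc d))) ≡ replicate (suc d) d
degrees-complete-allFin d = begin
  map (deg K) (allFin (suc d))           ≡⟨ map-cong-local (All.tabulate λ i∈ →
                                              suc-injective (trans (deg-complete Fin._≟_ (Unique.allFin⁺ (suc d)) i∈) (length-tabulate id))) ⟩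
  map (λ _ → d) (allFin (suc d))         ≡⟨ map-const d (allFin (suc d)) ⟩
  replicate (length (allFin (suc d))) d  ≡⟨ cong (λ m → replicate m d) (length-tabulate id) ⟩
  replicate (suc d) d                    ∎
  where
    open ≡-Reasoning
    K = complete Fin._≟_ (allFin (suc d)) (Unique.allFin⁺ (suc d))

-- Clearing the diagonal and symmetrising makes every Boolean matrix the adjacency matrix of a graph.
symmetrise : {m : ℕ} → (Fin m → Fin m → Bool) → Fin m → Fin m → Bool
symmetrise f i j = not (does (i Fin.≟ j)) ∧ (f i j ∨ f j i)

symmetrise-≗ : {m : ℕ} (f h : Fin m → Fin m → Bool) → (∀ i j → h i j ≡ f i j) → (∀ i j → f i j ≡ f j i) → (∀ i → ¬ T (f i i)) →
               ∀ i j → symmetrise h i j ≡ f i j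
symmetrise-≗ f h h≗f f-sym f-irrefl i j rewrite h≗f i j | h≗f j i | f-sym j i with i Fin.≟ j
... | yes refl = sym (¬-not (λ fii≡true → f-irrefl i (subst T (sym fii≡true) tt)))
... | no  _    = ∨-idem (f i j)

codeGraph : (m : ℕ) → Vec (Vec Bool m) m → Graph
codeGraph m c = record
  { n      = m
  ; adj    = symmetrise entry
  ; sym    = λ i j → cong₂ _∧_ (cong not (does-≟-sym Fin._≟_ i j)) (∨-comm (entry i j) _)
  ; irrefl = λ i → cong (λ b → not b ∧ (entry i i ∨ entry i i)) (dec-true (i Fin.≟ i) refl)
  }
  where
    entry : Fin m → Fin m → Bool
    entry i j = Vec.lookup (Vec.lookup c i) j

allVecs : {X : Set} → List X → (m : ℕ) → List (Vec X m)
allVecs xs zero    = Vec.[] ∷ []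
allVecs xs (suc m) = concatMap (λ x → map (x Vec.∷_) (allVecs xs m)) xs

∈-allVecs : {X : Set} {xs : List X} → (∀ x → x ∈ xs) → {m : ℕ} (v : Vec X m) → v ∈ allVecs xs m
∈-allVecs every Vec.[]      = here refl
∈-allVecs every (x Vec.∷ v) = ∈-concatMap⁺ _ (Any.map (λ { refl → ∈-map⁺ (x Vec.∷_) (∈-allVecs every v) }) (every x))

graphsOfOrder : ℕ → List Graph
graphsOfOrder m = map (codeGraph m) (allVecs (allVecs (true ∷ false ∷ []) m) m)

graphsUpTo : ℕ → List Graph
graphsUpTo N = concatMap graphsOfOrder (upTo (suc N))

codeGraph-∈ : {N m : ℕ} → m ≤ N → (c : Vec (Vec Bool m) m) → codeGraph m c ∈ graphsUpTo N
codeGraph-∈ {m = m} m≤N c =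
  ∈-concatMap⁺ graphsOfOrder (Any.map (λ { refl → ∈-map⁺ (codeGraph m) (∈-allVecs (∈-allVecs bool∈) c) }) (∈-upTo⁺ (s≤s m≤N)))
  where
    bool∈ : ∀ b → b ∈ true ∷ false ∷ []
    bool∈ true  = here refl
    bool∈ false = there (here refl)

module _ {A : Set} (g : ListGraph A) where

  private
    V = vertices g
    m = length V

    edgeMatrix : Fin m → Fin m → Bool
    edgeMatrix i j = edge g (lookup V i) (lookup V j)

    code : Vec (Vec Bool m) m
    code = Vec.tabulate λ i → Vec.tabulate (edgeMatrix i)

    H : Graph
    H = codeGraph m code

    map-lookup : map (lookup V) (allFin m) ≡ V
    map-lookup = trans (map-tabulate id (lookup V)) (tabulate-lookup V)

    adj-H : ∀ i j → adj H i j ≡ edgeMatrix i j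
    adj-H = symmetrise-≗ edgeMatrix _ (λ i j → trans (cong (λ r → Vec.lookup r j) (lookup∘tabulate _ i)) (lookup∘tabulate _ j))
              (λ i j → edge-sym g _ _) (λ i → edge-irrefl g _)

    degree-H : ∀ i → degree H i ≡ deg g (lookup V i)
    degree-H i = begin
      sum (map (λ j → if adj H i j then 1 else 0) (allFin m))
        ≡⟨ cong sum (map-cong (λ j → cong (λ b → if b then 1 else 0) (adj-H i j)) (allFin m)) ⟩
      sum (map (λ j → if edgeMatrix i j then 1 else 0) (allFin m))
        ≡⟨ sum-indicator (edgeMatrix i) (allFin m) ⟩
      length (filterᵇ (edgeMatrix i) (allFin m))
        ≡⟨ sym (length-map (lookup V) (filterᵇ (edgeMatrix i) (allFin m))) ⟩
      length (map (lookup V) (filterᵇ (edgeMatrix i) (allFin m)))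
        ≡⟨ cong length (sym (filter-map (T? ∘ edge g (lookup V i)) (lookup V) (allFin m))) ⟩
      length (filterᵇ (edge g (lookup V i)) (map (lookup V) (allFin m)))
        ≡⟨ cong (length ∘ filterᵇ (edge g (lookup V i))) map-lookup ⟩
      deg g (lookup V i) ∎
      where open ≡-Reasoning

  representative : {N : ℕ} → length (vertices g) ≤ N → Σ Graph λ H → H ∈ graphsUpTo N × degreeList H ≡ degrees g
  representative m≤N = H , codeGraph-∈ m≤N code , (begin
    map (degree H) (allFin m)                ≡⟨ map-cong degree-H (allFin m) ⟩
    map (deg g ∘ lookup V) (allFin m)        ≡⟨ map-∘ (allFin m) ⟩
    map (deg g) (map (lookup V) (allFin m))  ≡⟨ cong (map (deg g)) map-lookup ⟩
    degrees g                                ∎)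
    where open ≡-Reasoning

classBound : ℕ → ℕ
classBound k = suc k * 2 + ballSize k

orderBound : ℕ → ℕ
orderBound k = suc k * classBound k

clique-representative : {k d : ℕ} → d < suc k → Σ Graph λ K → K ∈ graphsUpTo (orderBound k) × degreeList K ≡ replicate (suc d) d
clique-representative {k} {d} d<1+k =
  let (K , K∈ , K-degrees) = representative (complete Fin._≟_ (allFin (suc d)) (Unique.allFin⁺ (suc d)))
                               (≤-trans (≤-reflexive (length-tabulate id)) (≤-trans d<1+k (m≤m*n (suc k) (classBound k))))
  in K , K∈ , trans K-degrees (degrees-complete-allFin d)

module Decompose {A : Set} (_≟_ : DecidableEquality A) (k : ℕ) where

  open PairingOff _≟_ k using (pair-off)

  twoCliques : ℕ → List ℕ
  twoCliques d = replicate (suc d) d ++ replicate (suc d) d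

  CliquesPeeled : ListGraph A → Set
  CliquesPeeled g = ∃ λ d → d < suc k × Σ (ListGraph A) λ g′ → degrees g ↭ twoCliques d ++ degrees g′

  peel-cliques : (g : ListGraph A) → MaxDegreeᴸ≤ g k → orderBound k < length (degrees g) → CliquesPeeled g
  peel-cliques g bounded large with pigeonhole (suc k) (degrees g) (All.map s≤s bounded) large
  ... | d , d<1+k , many with pair-off (suc d) d g bounded (≤-trans (+-monoˡ-≤ (ballSize k) (*-monoˡ-≤ 2 d<1+k)) (<⇒≤ many))
  ...   | g′ , g↭ = d , d<1+k , g′ , ↭-trans g↭ (↭-reflexive (sym (++-assoc (replicate (suc d) d) _ (degrees g′))))

  Decomposition : ListGraph A → Set
  Decomposition g = Σ (List Graph) λ Hs → All (_∈ graphsUpTo (orderBound k)) Hs × degrees g ↭ concatMap degreeList Hs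

  add-cliques : {g g′ : ListGraph A} {d : ℕ} → d < suc k → degrees g ↭ twoCliques d ++ degrees g′ → Decomposition g′ → Decomposition g
  add-cliques {d = d} d<1+k g↭ (Hs , Hs∈ , g′↭Hs) with clique-representative d<1+k
  ... | K , K∈ , K-degrees = K ∷ K ∷ Hs , K∈ ∷ K∈ ∷ Hs∈ ,
    ↭-trans g↭ (↭-trans (↭.++⁺ˡ (twoCliques d) g′↭Hs) (↭-reflexive (begin
    twoCliques d ++ concatMap degreeList Hs                                  ≡⟨ ++-assoc (replicate (suc d) d) _ _ ⟩
    replicate (suc d) d ++ replicate (suc d) d ++ concatMap degreeList Hs    ≡⟨ cong₂ (λ xs ys → xs ++ ys ++ concatMap degreeList Hs)
                                                                                       (sym K-degrees) (sym K-degrees) ⟩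
    concatMap degreeList (K ∷ K ∷ Hs)                                        ∎)))
    where open ≡-Reasoning

  decompose : (fuel : ℕ) (g : ListGraph A) → MaxDegreeᴸ≤ g k → length (degrees g) ≤ fuel → Decomposition g
  decompose fuel g bounded fits with length (degrees g) ≤? orderBound k
  ... | yes small with representative g (subst (_≤ orderBound k) (length-map (deg g) (vertices g)) small)
  ...   | H , H∈ , H-degrees = H ∷ [] , H∈ ∷ [] , ↭-reflexive (trans (sym H-degrees) (sym (++-identityʳ _)))
  decompose zero       g bounded fits | no large = ⊥-elim (large (≤-trans fits z≤n))
  decompose (suc fuel) g bounded fits | no large = recurse (peel-cliques g bounded (≰⇒> large))
    where
      recurse : CliquesPeeled g → Decomposition g
      recurse (d , d<1+k , g′ , g↭) = add-cliques {g} {g′} d<1+k g↭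
        (decompose fuel g′ (All-↭-suffix (twoCliques d) g↭ bounded)
                           (≤-pred (≤-trans (length-↭-suffix d (replicate d d ++ replicate (suc d) d) g↭) fits)))

corollary2 : (k : ℕ) → Σ (List Graph) λ Z →
    (G : Graph) → MaxDegree≤ G k →
      Σ (List Graph) λ Hs → All (_∈ Z) Hs × degreeSequence (⋃G Hs) ≡ degreeSequence G
corollary2 k = graphsUpTo (orderBound k) , λ G bounded →
  let open Decompose (Fin._≟_ {n G}) k
      (Hs , Hs∈ , G↭Hs) = decompose _ (fromGraph G) (maxDegree-fromGraph G bounded) ≤-refl
  in Hs , Hs∈ , degreeSequence-↭ (⋃G Hs) G
       (↭-trans (↭-reflexive (degreeList-⋃ Hs)) (↭-trans (↭-sym G↭Hs) (↭-reflexive (degrees-fromGraph G))))
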